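{- Define $f(k)=2^{(100k)^{10}}$. Let $p_0,p_1,\ldots$ be a sequence of integers such that $p_0\neq 0$ and for each $k\geq 1$, $$|p_k| > f(k)\cdot\Big(\sum_{i=0}^{k-1}|p_i|\Big).$$ Define $h(m,n)=\sum_{i=0}^{n}(-1)^i\binom{n}{i}p_{m+i}$ for integers $m,n\ge 0$. Then for every integer $t\geq 0$ and all integers $w_0,w_1,\ldots,w_t$, not all zero, with $0\leq w_j\leq\binom{t}{j}$ for each $j$, we have $$\sum_{j=0}^{t} w_j\, h(j,t-j)\neq 0.$$
   Context: Binomial conventions: $\binom{0}{0}=1$, and $\binom{a}{b}=0$ if $b<0$ or $b>a$. -}

module Defs where

open import Data.Nat as ℕ using (ℕ; zero; suc)
open import Data.Nat.Combinatorics using (_C_)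
open import Data.Integer as ℤ using (ℤ; +_; ∣_∣)
open import Data.Fin as Fin using (Fin; toℕ)

f : ℕ → ℕ
f k = 2 ℕ.^ ((100 ℕ.* k) ℕ.^ 10)

sumℕ : ℕ → (ℕ → ℕ) → ℕ
sumℕ zero    g = 0
sumℕ (suc n) g = sumℕ n g ℕ.+ g n

sumℤ : ℕ → (ℕ → ℤ) → ℤ
sumℤ zero    g = + 0
sumℤ (suc n) g = sumℤ n g ℤ.+ g n

sign : ℕ → ℤ
sign zero    = + 1
sign (suc i) = ℤ.- sign i

Growth : (ℕ → ℤ) → Set
Growth p = ∀ k → 1 ℕ.≤ k → f k ℕ.* sumℕ k (λ i → ∣ p i ∣) ℕ.< ∣ p k ∣

h : (ℕ → ℤ) → ℕ → ℕ → ℤ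
h p m n = sumℤ (suc n) (λ i → sign i ℤ.* (+ (n C i)) ℤ.* p (m ℕ.+ i))

sumFin : (n : ℕ) → (Fin n → ℤ) → ℤ
sumFin zero    g = + 0
sumFin (suc n) g = g Fin.zero ℤ.+ sumFin n (λ j → g (Fin.suc j))

weightedSum : (ℕ → ℤ) → (t : ℕ) → (Fin (suc t) → ℕ) → ℤ
weightedSum p t w = sumFin (suc t) (λ j → (+ w j) ℤ.* h p (toℕ j) (t ℕ.∸ toℕ j))

-- Expanding h, the weighted sum is ∑_{k ≤ t} c_k p_k with integer coefficients c_k (coeff),
-- and the growth of p lets the last index K with c_K ≠ 0 dominate as soon as |c_k| ≤ f(K)
-- for k < K. The c_k do not all vanish because ∑_k c_k 2^(t-k) = ∑_j w_j.
--
-- The bound on c_k must not depend on t. Since ∑_k c_k x^k (x+y)^(t-k) = ∑_j w_j x^j y^(t-j),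
-- taking y = K - x shows that the polynomial ∑_{k ≤ K} c_k K^(t-k) x^k (the c_k vanish beyond K)
-- takes values of size at most ∑_j C(t,j) x^j (K-x)^(t-j) = K^t at x = 0, …, K. Finite differences bound the
-- coefficients of such a polynomial by its values on 0, …, K times a factor depending on K only:
-- Δ^m kills x^k for k < m and sends x^m to m!, so the coefficients are controlled downwards
-- from the leading one. Dividing by K^(t-k) gives |c_k| ≤ K^K · coeffBound K ≤ f(K).

module Submission where

open import Defs
open import Data.Nat as ℕ using (ℕ; zero; suc; _≤_; _<_; z≤n; s≤s; NonZero; _!)
import Data.Nat.Properties as ℕP
open import Data.Nat.Combinatorics using (_C_; nCn≡1; nC1≡n; nCk≡nC[n∸k])
open import Data.Integer as ℤ using (ℤ; +_; ∣_∣; _+_; _*_; -_; _-_; _^_)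
import Data.Integer.Properties as ℤP
open import Data.Fin as Fin using (Fin; toℕ)
import Data.Fin.Properties as FinP
import Data.Vec.Functional as Vector
open import Data.Sum using (inj₁; inj₂)
open import Data.Product using (∃; _,_; _×_)
open import Data.Empty using (⊥-elim)
open import Relation.Nullary using (¬_; yes; no)
open import Relation.Binary.PropositionalEquality
open import Function using (_$_)
open import Data.Integer.Tactic.RingSolver using (solve-∀)
import Data.Nat.Tactic.RingSolver as ℕSolver
import Algebra.Properties.CommutativeSemiring.Binomial as Binomial
import Algebra.Definitions.RawMonoid as RawMonoid
open import Algebra.Properties.AbelianGroup ℤP.+-0-abelianGroup using (inverseʳ-unique)

sumℤ-cong : ∀ n {f g : ℕ → ℤ} → (∀ i → i < n → f i ≡ g i) → sumℤ n f ≡ sumℤ n g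
sumℤ-cong zero    eq = refl
sumℤ-cong (suc n) eq = cong₂ _+_ (sumℤ-cong n (λ i i<n → eq i (ℕP.m<n⇒m<1+n i<n))) (eq n ℕP.≤-refl)

sumℤ-zero : ∀ n (g : ℕ → ℤ) → (∀ i → i < n → g i ≡ + 0) → sumℤ n g ≡ + 0
sumℤ-zero zero    g eq = refl
sumℤ-zero (suc n) g eq =
  cong₂ _+_ (sumℤ-zero n g (λ i i<n → eq i (ℕP.m<n⇒m<1+n i<n))) (eq n ℕP.≤-refl)

sumℤ-distrib-+ : ∀ n (f g : ℕ → ℤ) → sumℤ n (λ i → f i + g i) ≡ sumℤ n f + sumℤ n g
sumℤ-distrib-+ zero    f g = refl
sumℤ-distrib-+ (suc n) f g = begin
  sumℤ n (λ i → f i + g i) + (f n + g n) ≡⟨ cong (_+ (f n + g n)) (sumℤ-distrib-+ n f g) ⟩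
  (sumℤ n f + sumℤ n g) + (f n + g n)    ≡⟨ interchange (sumℤ n f) (sumℤ n g) (f n) (g n) ⟩
  (sumℤ n f + f n) + (sumℤ n g + g n)    ∎
  where
  open ≡-Reasoning
  interchange : ∀ a b c d → (a + b) + (c + d) ≡ (a + c) + (b + d)
  interchange = solve-∀

*-distribˡ-sumℤ : ∀ n (a : ℤ) (f : ℕ → ℤ) → a * sumℤ n f ≡ sumℤ n (λ i → a * f i)
*-distribˡ-sumℤ zero    a f = ℤP.*-zeroʳ a
*-distribˡ-sumℤ (suc n) a f =
  trans (ℤP.*-distribˡ-+ a (sumℤ n f) (f n)) (cong (_+ a * f n) (*-distribˡ-sumℤ n a f))

*-distribʳ-sumℤ : ∀ n (a : ℤ) (f : ℕ → ℤ) → sumℤ n f * a ≡ sumℤ n (λ i → f i * a)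
*-distribʳ-sumℤ n a f = begin
  sumℤ n f * a              ≡⟨ ℤP.*-comm (sumℤ n f) a ⟩
  a * sumℤ n f              ≡⟨ *-distribˡ-sumℤ n a f ⟩
  sumℤ n (λ i → a * f i)    ≡⟨ sumℤ-cong n (λ i _ → ℤP.*-comm a (f i)) ⟩
  sumℤ n (λ i → f i * a)    ∎
  where open ≡-Reasoning

sumℤ-suc-head : ∀ n (g : ℕ → ℤ) → sumℤ (suc n) g ≡ g 0 + sumℤ n (λ i → g (suc i))
sumℤ-suc-head zero    g = ℤP.+-comm (+ 0) (g 0)
sumℤ-suc-head (suc n) g = begin
  sumℤ (suc n) g + g (suc n)                   ≡⟨ cong (_+ g (suc n)) (sumℤ-suc-head n g) ⟩
  (g 0 + sumℤ n (λ i → g (suc i))) + g (suc n) ≡⟨ ℤP.+-assoc (g 0) _ _ ⟩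
  g 0 + sumℤ (suc n) (λ i → g (suc i))         ∎
  where open ≡-Reasoning

sumℤ-split : ∀ m n (g : ℕ → ℤ) → sumℤ (m ℕ.+ n) g ≡ sumℤ m g + sumℤ n (λ i → g (m ℕ.+ i))
sumℤ-split m zero    g = trans (cong (λ k → sumℤ k g) (ℕP.+-identityʳ m)) (sym (ℤP.+-identityʳ _))
sumℤ-split m (suc n) g = begin
  sumℤ (m ℕ.+ suc n) g                                   ≡⟨ cong (λ k → sumℤ k g) (ℕP.+-suc m n) ⟩
  sumℤ (m ℕ.+ n) g + g (m ℕ.+ n)                         ≡⟨ cong (_+ g (m ℕ.+ n)) (sumℤ-split m n g) ⟩
  (sumℤ m g + sumℤ n (λ i → g (m ℕ.+ i))) + g (m ℕ.+ n)  ≡⟨ ℤP.+-assoc (sumℤ m g) _ _ ⟩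
  sumℤ m g + sumℤ (suc n) (λ i → g (m ℕ.+ i))            ∎
  where open ≡-Reasoning

sumℤ-truncate : ∀ {m n} (g : ℕ → ℤ) → m ≤ n → (∀ k → m ≤ k → k < n → g k ≡ + 0) →
                sumℤ n g ≡ sumℤ m g
sumℤ-truncate {m} {n} g m≤n vanish = begin
  sumℤ n g                                              ≡⟨ cong (λ k → sumℤ k g) (sym (ℕP.m+[n∸m]≡n m≤n)) ⟩
  sumℤ (m ℕ.+ (n ℕ.∸ m)) g                              ≡⟨ sumℤ-split m (n ℕ.∸ m) g ⟩
  sumℤ m g + sumℤ (n ℕ.∸ m) (λ i → g (m ℕ.+ i))         ≡⟨ cong (λ z → sumℤ m g + z) (sumℤ-zero (n ℕ.∸ m) _ tail-vanishes) ⟩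
  sumℤ m g + + 0                                        ≡⟨ ℤP.+-identityʳ (sumℤ m g) ⟩
  sumℤ m g                                              ∎
  where
  open ≡-Reasoning
  tail-vanishes : ∀ i → i < n ℕ.∸ m → g (m ℕ.+ i) ≡ + 0
  tail-vanishes i i<n∸m = vanish (m ℕ.+ i) (ℕP.m≤m+n m i)
    (subst (m ℕ.+ i <_) (ℕP.m+[n∸m]≡n m≤n) (ℕP.+-monoʳ-< m i<n∸m))

pos-sumℕ : ∀ n (g : ℕ → ℕ) → + sumℕ n g ≡ sumℤ n (λ i → + g i)
pos-sumℕ zero    g = refl
pos-sumℕ (suc n) g = trans (ℤP.pos-+ (sumℕ n g) (g n)) (cong (_+ + g n) (pos-sumℕ n g))

∣sumℤ∣≤sumℕ∣∣ : ∀ n (g : ℕ → ℤ) → ∣ sumℤ n g ∣ ≤ sumℕ n (λ i → ∣ g i ∣)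
∣sumℤ∣≤sumℕ∣∣ zero    g = z≤n
∣sumℤ∣≤sumℕ∣∣ (suc n) g =
  ℕP.≤-trans (ℤP.∣i+j∣≤∣i∣+∣j∣ (sumℤ n g) (g n)) (ℕP.+-monoˡ-≤ ∣ g n ∣ (∣sumℤ∣≤sumℕ∣∣ n g))

sumℕ-mono-≤ : ∀ n {f g : ℕ → ℕ} → (∀ i → i < n → f i ≤ g i) → sumℕ n f ≤ sumℕ n g
sumℕ-mono-≤ zero    le = z≤n
sumℕ-mono-≤ (suc n) le = ℕP.+-mono-≤ (sumℕ-mono-≤ n (λ i i<n → le i (ℕP.m<n⇒m<1+n i<n))) (le n ℕP.≤-refl)

sumℕ-const-≤ : ∀ n {f : ℕ → ℕ} {b} → (∀ i → i < n → f i ≤ b) → sumℕ n f ≤ n ℕ.* b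
sumℕ-const-≤ zero    le = z≤n
sumℕ-const-≤ (suc n) {b = b} le = ℕP.≤-trans
  (ℕP.+-mono-≤ (sumℕ-const-≤ n (λ i i<n → le i (ℕP.m<n⇒m<1+n i<n))) (le n ℕP.≤-refl))
  (ℕP.≤-reflexive (ℕP.+-comm (n ℕ.* b) b))

*-distribˡ-sumℕ : ∀ n a (f : ℕ → ℕ) → a ℕ.* sumℕ n f ≡ sumℕ n (λ i → a ℕ.* f i)
*-distribˡ-sumℕ zero    a f = ℕP.*-zeroʳ a
*-distribˡ-sumℕ (suc n) a f =
  trans (ℕP.*-distribˡ-+ a (sumℕ n f) (f n)) (cong (ℕ._+ a ℕ.* f n) (*-distribˡ-sumℕ n a f))

term≤sumℕ : ∀ n (f : ℕ → ℕ) {i} → i < n → f i ≤ sumℕ n f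
term≤sumℕ (suc n) f {i} i<1+n with ℕP.m≤n⇒m<n∨m≡n (ℕP.≤-pred i<1+n)
... | inj₁ i<n  = ℕP.≤-trans (term≤sumℕ n f i<n) (ℕP.m≤m+n _ _)
... | inj₂ refl = ℕP.m≤n+m _ _

sumFin-cong : ∀ n {f g : Fin n → ℤ} → (∀ k → f k ≡ g k) → sumFin n f ≡ sumFin n g
sumFin-cong zero    eq = refl
sumFin-cong (suc n) eq = cong₂ _+_ (eq Fin.zero) (sumFin-cong n (λ k → eq (Fin.suc k)))

sumFin≡sumℤ : ∀ n (g : ℕ → ℤ) → sumFin n (λ k → g (toℕ k)) ≡ sumℤ n g
sumFin≡sumℤ zero    g = refl
sumFin≡sumℤ (suc n) g =
  trans (cong (λ w → g 0 + w) (sumFin≡sumℤ n (λ i → g (suc i)))) (sym (sumℤ-suc-head n g))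

pos-^ : ∀ m n → + (m ℕ.^ n) ≡ (+ m) ^ n
pos-^ m zero    = refl
pos-^ m (suc n) = trans (ℤP.pos-* m (m ℕ.^ n)) (cong (+ m *_) (pos-^ m n))

∣pos-^∣ : ∀ m n → ∣ (+ m) ^ n ∣ ≡ m ℕ.^ n
∣pos-^∣ m n = cong ∣_∣ (sym (pos-^ m n))

-- The library states the binomial theorem with the semiring's own multiples and powers
-- (RawMonoid._×_) and sums as right folds over Fin.
binomial-theorem : ∀ n (x y : ℤ) →
  (x + y) ^ n ≡ sumℤ (suc n) (λ i → + (n C i) * (x ^ i * y ^ (n ℕ.∸ i)))
binomial-theorem n x y = begin
  (x + y) ^ n                                  ≡⟨ semiring-^ n (x + y) ⟨
  RawMonoid._×_ ℤ.*-1-rawMonoid n (x + y)      ≡⟨ Binomial.theorem ℤP.+-*-commutativeSemiring n x y ⟩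
  Vector.foldr _+_ (+ 0) expansion             ≡⟨ foldr≡sumFin (suc n) expansion ⟩
  sumFin (suc n) expansion                     ≡⟨ sumFin-cong (suc n) (λ k → expansion-term (toℕ k)) ⟩
  sumFin (suc n) (λ k → term (toℕ k))          ≡⟨ sumFin≡sumℤ (suc n) term ⟩
  sumℤ (suc n) term                            ∎
  where
  open ≡-Reasoning
  expansion : Fin (suc n) → ℤ
  expansion = Binomial.binomialTerm ℤP.+-*-commutativeSemiring x y n
  term : ℕ → ℤ
  term i = + (n C i) * (x ^ i * y ^ (n ℕ.∸ i))
  semiring-× : ∀ m (z : ℤ) → RawMonoid._×_ ℤ.+-0-rawMonoid m z ≡ + m * z
  semiring-× zero    z = refl
  semiring-× (suc m) z = begin
    z + RawMonoid._×_ ℤ.+-0-rawMonoid m z ≡⟨ cong (λ w → z + w) (semiring-× m z) ⟩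
    z + + m * z                           ≡⟨ cong (_+ + m * z) (ℤP.*-identityˡ z) ⟨
    + 1 * z + + m * z                     ≡⟨ ℤP.*-distribʳ-+ z (+ 1) (+ m) ⟨
    + suc m * z                           ∎
  semiring-^ : ∀ m (z : ℤ) → RawMonoid._×_ ℤ.*-1-rawMonoid m z ≡ z ^ m
  semiring-^ zero    z = refl
  semiring-^ (suc m) z = cong (z *_) (semiring-^ m z)
  foldr≡sumFin : ∀ m (v : Fin m → ℤ) → Vector.foldr _+_ (+ 0) v ≡ sumFin m v
  foldr≡sumFin zero    v = refl
  foldr≡sumFin (suc m) v = cong (λ w → v Fin.zero + w) (foldr≡sumFin m (λ k → v (Fin.suc k)))
  expansion-term : ∀ i → RawMonoid._×_ ℤ.+-0-rawMonoid (n C i)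
                           (RawMonoid._×_ ℤ.*-1-rawMonoid i x * RawMonoid._×_ ℤ.*-1-rawMonoid (n ℕ.∸ i) y)
                       ≡ term i
  expansion-term i = trans (semiring-× (n C i) _)
    (cong (+ (n C i) *_) (cong₂ _*_ (semiring-^ i x) (semiring-^ (n ℕ.∸ i) y)))

pos-monomial : ∀ c a b i j → + (c ℕ.* (a ℕ.^ i ℕ.* b ℕ.^ j)) ≡ + c * ((+ a) ^ i * (+ b) ^ j)
pos-monomial c a b i j = begin
  + (c ℕ.* (a ℕ.^ i ℕ.* b ℕ.^ j))          ≡⟨ ℤP.pos-* c _ ⟩
  + c * + (a ℕ.^ i ℕ.* b ℕ.^ j)            ≡⟨ cong (+ c *_) (ℤP.pos-* (a ℕ.^ i) _) ⟩
  + c * (+ (a ℕ.^ i) * + (b ℕ.^ j))        ≡⟨ cong (+ c *_) (cong₂ _*_ (pos-^ a i) (pos-^ b j)) ⟩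
  + c * ((+ a) ^ i * (+ b) ^ j)            ∎
  where open ≡-Reasoning

pos-sumℕ-monomials : ∀ n (c : ℕ → ℕ) a b →
  + sumℕ (suc n) (λ i → c i ℕ.* (a ℕ.^ i ℕ.* b ℕ.^ (n ℕ.∸ i)))
  ≡ sumℤ (suc n) (λ i → + c i * ((+ a) ^ i * (+ b) ^ (n ℕ.∸ i)))
pos-sumℕ-monomials n c a b =
  trans (pos-sumℕ (suc n) _) (sumℤ-cong (suc n) λ i _ → pos-monomial (c i) a b i (n ℕ.∸ i))

binomial-theoremℕ : ∀ n a b →
  (a ℕ.+ b) ℕ.^ n ≡ sumℕ (suc n) (λ i → (n C i) ℕ.* (a ℕ.^ i ℕ.* b ℕ.^ (n ℕ.∸ i)))
binomial-theoremℕ n a b = ℤP.+-injective (begin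
  + ((a ℕ.+ b) ℕ.^ n)                                                 ≡⟨ pos-^ (a ℕ.+ b) n ⟩
  (+ a + + b) ^ n                                                     ≡⟨ binomial-theorem n (+ a) (+ b) ⟩
  sumℤ (suc n) (λ i → + (n C i) * ((+ a) ^ i * (+ b) ^ (n ℕ.∸ i)))   ≡⟨ pos-sumℕ-monomials n (n C_) a b ⟨
  + sumℕ (suc n) (λ i → (n C i) ℕ.* (a ℕ.^ i ℕ.* b ℕ.^ (n ℕ.∸ i)))   ∎)
  where open ≡-Reasoning

Δ : ℕ → (ℕ → ℤ) → ℤ
Δ zero    g = g 0
Δ (suc m) g = Δ m (λ x → g (suc x)) - Δ m g

Δ-cong : ∀ m {f g : ℕ → ℤ} → (∀ x → f x ≡ g x) → Δ m f ≡ Δ m g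
Δ-cong zero    eq = eq 0
Δ-cong (suc m) eq = cong₂ _-_ (Δ-cong m (λ x → eq (suc x))) (Δ-cong m eq)

Δ-+ : ∀ m (f g : ℕ → ℤ) → Δ m (λ x → f x + g x) ≡ Δ m f + Δ m g
Δ-+ zero    f g = refl
Δ-+ (suc m) f g = begin
  Δ m (λ x → f (suc x) + g (suc x)) - Δ m (λ x → f x + g x) ≡⟨ cong₂ _-_ (Δ-+ m _ _) (Δ-+ m f g) ⟩
  (Δ m f′ + Δ m g′) - (Δ m f + Δ m g)                       ≡⟨ regroup (Δ m f′) (Δ m g′) (Δ m f) (Δ m g) ⟩
  (Δ m f′ - Δ m f) + (Δ m g′ - Δ m g)                       ∎
  where
  open ≡-Reasoning
  f′ g′ : ℕ → ℤ
  f′ x = f (suc x)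
  g′ x = g (suc x)
  regroup : ∀ a b c d → (a + b) - (c + d) ≡ (a - c) + (b - d)
  regroup = solve-∀

Δ-*ˡ : ∀ m a (f : ℕ → ℤ) → Δ m (λ x → a * f x) ≡ a * Δ m f
Δ-*ˡ zero    a f = refl
Δ-*ˡ (suc m) a f =
  trans (cong₂ _-_ (Δ-*ˡ m a _) (Δ-*ˡ m a f)) (factor a (Δ m (λ x → f (suc x))) (Δ m f))
  where
  factor : ∀ a b c → a * b - a * c ≡ a * (b - c)
  factor = solve-∀

Δ-- : ∀ m (f g : ℕ → ℤ) → Δ m (λ x → f x - g x) ≡ Δ m f - Δ m g
Δ-- m f g = begin
  Δ m (λ x → f x - g x)           ≡⟨ Δ-+ m f (λ x → - g x) ⟩
  Δ m f + Δ m (λ x → - g x)       ≡⟨ cong (λ z → Δ m f + z) (Δ-cong m (λ x → negate (g x))) ⟩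
  Δ m f + Δ m (λ x → - + 1 * g x) ≡⟨ cong (λ z → Δ m f + z) (Δ-*ˡ m (- + 1) g) ⟩
  Δ m f + - + 1 * Δ m g           ≡⟨ cong (λ z → Δ m f + z) (sym (negate (Δ m g))) ⟩
  Δ m f - Δ m g                   ∎
  where
  open ≡-Reasoning
  negate : ∀ z → - z ≡ - + 1 * z
  negate = solve-∀

Δ-zero : ∀ m → Δ m (λ _ → + 0) ≡ + 0
Δ-zero zero    = refl
Δ-zero (suc m) = cong₂ _-_ (Δ-zero m) (Δ-zero m)

Δ-sumℤ : ∀ m n (G : ℕ → ℕ → ℤ) → Δ m (λ x → sumℤ n (λ k → G k x)) ≡ sumℤ n (λ k → Δ m (G k))
Δ-sumℤ m zero    G = Δ-zero m
Δ-sumℤ m (suc n) G = trans (Δ-+ m _ _) (cong (_+ Δ m (G n)) (Δ-sumℤ m n G))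

∣Δ∣≤ : ∀ m (g : ℕ → ℤ) M → (∀ x → x ≤ m → ∣ g x ∣ ≤ M) → ∣ Δ m g ∣ ≤ 2 ℕ.^ m ℕ.* M
∣Δ∣≤ zero    g M bound = ℕP.≤-trans (bound 0 z≤n) (ℕP.≤-reflexive (sym (ℕP.+-identityʳ M)))
∣Δ∣≤ (suc m) g M bound = begin
  ∣ Δ m g′ - Δ m g ∣                ≤⟨ ℤP.∣i-j∣≤∣i∣+∣j∣ (Δ m g′) (Δ m g) ⟩
  ∣ Δ m g′ ∣ ℕ.+ ∣ Δ m g ∣          ≤⟨ ℕP.+-mono-≤ (∣Δ∣≤ m g′ M shifted) (∣Δ∣≤ m g M unshifted) ⟩
  2 ℕ.^ m ℕ.* M ℕ.+ 2 ℕ.^ m ℕ.* M   ≡⟨ double (2 ℕ.^ m) M ⟩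
  2 ℕ.^ suc m ℕ.* M                 ∎
  where
  open ℕP.≤-Reasoning
  g′ : ℕ → ℤ
  g′ x = g (suc x)
  shifted : ∀ x → x ≤ m → ∣ g′ x ∣ ≤ M
  shifted x x≤m = bound (suc x) (s≤s x≤m)
  unshifted : ∀ x → x ≤ m → ∣ g x ∣ ≤ M
  unshifted x x≤m = bound x (ℕP.m≤n⇒m≤1+n x≤m)
  double : ∀ a b → a ℕ.* b ℕ.+ a ℕ.* b ≡ 2 ℕ.* a ℕ.* b
  double = ℕSolver.solve-∀

[1+x]^i-x^i : ∀ i x → (+ suc x) ^ i - (+ x) ^ i ≡ sumℤ i (λ l → + (i C l) * (+ x) ^ l)
[1+x]^i-x^i i x = begin
  (+ suc x) ^ i - (+ x) ^ i                  ≡⟨ cong (λ z → z ^ i - (+ x) ^ i) (ℤP.+-comm (+ 1) (+ x)) ⟩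
  (+ x + + 1) ^ i - (+ x) ^ i                ≡⟨ cong (_- (+ x) ^ i) (binomial-theorem i (+ x) (+ 1)) ⟩
  (sumℤ i term + term i) - (+ x) ^ i         ≡⟨ cong (λ z → (sumℤ i term + z) - (+ x) ^ i) top-term ⟩
  (sumℤ i term + (+ x) ^ i) - (+ x) ^ i      ≡⟨ cancel (sumℤ i term) ((+ x) ^ i) ⟩
  sumℤ i term                                ≡⟨ sumℤ-cong i (λ l _ → drop-one l) ⟩
  sumℤ i (λ l → + (i C l) * (+ x) ^ l)       ∎
  where
  open ≡-Reasoning
  term : ℕ → ℤ
  term l = + (i C l) * ((+ x) ^ l * (+ 1) ^ (i ℕ.∸ l))
  drop-one : ∀ l → term l ≡ + (i C l) * (+ x) ^ l
  drop-one l = cong (λ z → + (i C l) * z)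
    (trans (cong ((+ x) ^ l *_) (ℤP.^-zeroˡ (i ℕ.∸ l))) (ℤP.*-identityʳ ((+ x) ^ l)))
  top-term : term i ≡ (+ x) ^ i
  top-term rewrite nCn≡1 i | ℕP.n∸n≡0 i = trans (ℤP.*-identityˡ _) (ℤP.*-identityʳ _)
  cancel : ∀ a b → (a + b) - b ≡ a
  cancel = solve-∀

Δ-^-suc : ∀ m i → Δ (suc m) (λ x → (+ x) ^ i) ≡ sumℤ i (λ l → + (i C l) * Δ m (λ x → (+ x) ^ l))
Δ-^-suc m i = begin
  Δ m (λ x → (+ suc x) ^ i) - Δ m (λ x → (+ x) ^ i)    ≡⟨ sym (Δ-- m _ _) ⟩
  Δ m (λ x → (+ suc x) ^ i - (+ x) ^ i)                ≡⟨ Δ-cong m ([1+x]^i-x^i i) ⟩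
  Δ m (λ x → sumℤ i (λ l → + (i C l) * (+ x) ^ l))     ≡⟨ Δ-sumℤ m i (λ l x → + (i C l) * (+ x) ^ l) ⟩
  sumℤ i (λ l → Δ m (λ x → + (i C l) * (+ x) ^ l))     ≡⟨ sumℤ-cong i (λ l _ → Δ-*ˡ m (+ (i C l)) (λ x → (+ x) ^ l)) ⟩
  sumℤ i (λ l → + (i C l) * Δ m (λ x → (+ x) ^ l))     ∎
  where open ≡-Reasoning

Δ-^-< : ∀ m i → i < m → Δ m (λ x → (+ x) ^ i) ≡ + 0
Δ-^-< (suc m) i i<1+m = trans (Δ-^-suc m i) (sumℤ-zero i _ λ l l<i →
  trans (cong (+ (i C l) *_) (Δ-^-< m l (ℕP.<-≤-trans l<i (ℕP.≤-pred i<1+m)))) (ℤP.*-zeroʳ (+ (i C l))))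

Δ-^-self : ∀ m → Δ m (λ x → (+ x) ^ m) ≡ + (m !)
Δ-^-self zero    = refl
Δ-^-self (suc m) = begin
  Δ (suc m) (λ x → (+ x) ^ suc m)                          ≡⟨ Δ-^-suc m (suc m) ⟩
  sumℤ m lower + + (suc m C m) * Δ m (λ x → (+ x) ^ m)     ≡⟨ cong₂ _+_ (sumℤ-zero m lower lower-vanishes)
                                                                        (cong₂ _*_ (cong +_ [1+m]Cm≡1+m) (Δ-^-self m)) ⟩
  + 0 + + suc m * + (m !)                                  ≡⟨ ℤP.+-identityˡ _ ⟩
  + suc m * + (m !)                                        ≡⟨ sym (ℤP.pos-* (suc m) (m !)) ⟩
  + (suc m !)                                              ∎
  where
  open ≡-Reasoning
  lower : ℕ → ℤ
  lower l = + (suc m C l) * Δ m (λ x → (+ x) ^ l)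
  lower-vanishes : ∀ l → l < m → lower l ≡ + 0
  lower-vanishes l l<m = trans (cong (+ (suc m C l) *_) (Δ-^-< m l l<m)) (ℤP.*-zeroʳ (+ (suc m C l)))
  [1+m]Cm≡1+m : suc m C m ≡ suc m
  [1+m]Cm≡1+m = begin
    suc m C m               ≡⟨ nCk≡nC[n∸k] (ℕP.n≤1+n m) ⟩
    suc m C (suc m ℕ.∸ m)   ≡⟨ cong (suc m C_) (ℕP.m+n∸n≡m 1 m) ⟩
    suc m C 1               ≡⟨ nC1≡n (suc m) ⟩
    suc m                   ∎

poly : (ℕ → ℤ) → ℕ → ℕ → ℤ
poly b n x = sumℤ n (λ k → b k * (+ x) ^ k)

Δ-poly : ∀ m (b : ℕ → ℤ) → Δ m (poly b (suc m)) ≡ b m * + (m !)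
Δ-poly m b = begin
  Δ m (poly b (suc m))                                          ≡⟨ Δ-sumℤ m (suc m) (λ k x → b k * (+ x) ^ k) ⟩
  sumℤ m (λ k → Δ m (monomial k)) + Δ m (monomial m)            ≡⟨ cong₂ _+_ (sumℤ-zero m _ lower-vanishes) top ⟩
  + 0 + b m * + (m !)                                           ≡⟨ ℤP.+-identityˡ _ ⟩
  b m * + (m !)                                                 ∎
  where
  open ≡-Reasoning
  monomial : ℕ → ℕ → ℤ
  monomial k x = b k * (+ x) ^ k
  Δ-monomial : ∀ k → Δ m (monomial k) ≡ b k * Δ m (λ x → (+ x) ^ k)
  Δ-monomial k = Δ-*ˡ m (b k) (λ x → (+ x) ^ k)
  top : Δ m (monomial m) ≡ b m * + (m !)
  top = trans (Δ-monomial m) (cong (b m *_) (Δ-^-self m))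
  lower-vanishes : ∀ k → k < m → Δ m (monomial k) ≡ + 0
  lower-vanishes k k<m = trans (Δ-monomial k) (trans (cong (b k *_) (Δ-^-< m k k<m)) (ℤP.*-zeroʳ (b k)))

^≤^-self : ∀ {x k n} → x ≤ n → k ≤ n → x ℕ.^ k ≤ n ℕ.^ n
^≤^-self {n = zero}  z≤n z≤n = ℕP.≤-refl
^≤^-self {k = k} {n = suc n} x≤n k≤n = ℕP.≤-trans (ℕP.^-monoˡ-≤ k x≤n) (ℕP.^-monoʳ-≤ (suc n) k≤n)

coeffRatio : ℕ → ℕ
coeffRatio n = 2 ℕ.^ n ℕ.* (1 ℕ.+ n ℕ.^ suc n)

coeffBound : ℕ → ℕ
coeffBound n = coeffRatio n ℕ.^ suc n

module _ (n : ℕ) (b : ℕ → ℤ) (M : ℕ) (bounded : ∀ x → x ≤ n → ∣ poly b (suc n) x ∣ ≤ M) where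

  private
    UpperCoeffs≤ : ℕ → ℕ → Set
    UpperCoeffs≤ m Y = ∀ k → m < k → k ≤ n → ∣ b k ∣ ≤ Y

  ∣truncated-poly∣≤ : ∀ {m Y} → m ≤ n → UpperCoeffs≤ m Y →
                      ∀ x → x ≤ n → ∣ poly b (suc m) x ∣ ≤ M ℕ.+ n ℕ.* (Y ℕ.* n ℕ.^ n)
  ∣truncated-poly∣≤ {m} {Y} m≤n upper x x≤n = begin
    ∣ poly b (suc m) x ∣                 ≡⟨ cong ∣_∣ prefix≡full-tail ⟩
    ∣ poly b (suc n) x - tail ∣          ≤⟨ ℤP.∣i-j∣≤∣i∣+∣j∣ (poly b (suc n) x) tail ⟩
    ∣ poly b (suc n) x ∣ ℕ.+ ∣ tail ∣    ≤⟨ ℕP.+-mono-≤ (bounded x x≤n) ∣tail∣≤ ⟩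
    M ℕ.+ n ℕ.* (Y ℕ.* n ℕ.^ n)          ∎
    where
    open ℕP.≤-Reasoning
    monomial : ℕ → ℤ
    monomial k = b k * (+ x) ^ k
    tail : ℤ
    tail = sumℤ (n ℕ.∸ m) (λ i → monomial (suc m ℕ.+ i))
    prefix≡full-tail : poly b (suc m) x ≡ poly b (suc n) x - tail
    prefix≡full-tail = sym (trans (cong (_- tail) full≡prefix+tail) (cancel (poly b (suc m) x) tail))
      where
      full≡prefix+tail : poly b (suc n) x ≡ poly b (suc m) x + tail
      full≡prefix+tail = trans (cong (λ l → sumℤ (suc l) monomial) (sym (ℕP.m+[n∸m]≡n m≤n)))
                               (sumℤ-split (suc m) (n ℕ.∸ m) monomial)
      cancel : ∀ q r → q + r - r ≡ q
      cancel = solve-∀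
    in-tail : ∀ i → i < n ℕ.∸ m → suc m ℕ.+ i ≤ n
    in-tail i i<n∸m = subst (suc m ℕ.+ i ≤_) (ℕP.m+[n∸m]≡n m≤n)
      (subst (_≤ m ℕ.+ (n ℕ.∸ m)) (ℕP.+-suc m i) (ℕP.+-monoʳ-≤ m i<n∸m))
    ∣monomial∣≤ : ∀ i → i < n ℕ.∸ m → ∣ monomial (suc m ℕ.+ i) ∣ ≤ Y ℕ.* n ℕ.^ n
    ∣monomial∣≤ i i<n∸m = begin
      ∣ monomial k ∣          ≡⟨ trans (ℤP.abs-* (b k) ((+ x) ^ k)) (cong (∣ b k ∣ ℕ.*_) (∣pos-^∣ x k)) ⟩
      ∣ b k ∣ ℕ.* x ℕ.^ k     ≤⟨ ℕP.*-mono-≤ (upper k (s≤s (ℕP.m≤m+n m i)) (in-tail i i<n∸m))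
                                              (^≤^-self x≤n (in-tail i i<n∸m)) ⟩
      Y ℕ.* n ℕ.^ n           ∎
      where
      k : ℕ
      k = suc m ℕ.+ i
    ∣tail∣≤ : ∣ tail ∣ ≤ n ℕ.* (Y ℕ.* n ℕ.^ n)
    ∣tail∣≤ = begin
      ∣ tail ∣                                                 ≤⟨ ∣sumℤ∣≤sumℕ∣∣ (n ℕ.∸ m) _ ⟩
      sumℕ (n ℕ.∸ m) (λ i → ∣ monomial (suc m ℕ.+ i) ∣)        ≤⟨ sumℕ-const-≤ (n ℕ.∸ m) ∣monomial∣≤ ⟩
      (n ℕ.∸ m) ℕ.* (Y ℕ.* n ℕ.^ n)                            ≤⟨ ℕP.*-monoˡ-≤ _ (ℕP.m∸n≤m n m) ⟩
      n ℕ.* (Y ℕ.* n ℕ.^ n)                                    ∎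

  ∣poly-coeff∣≤-step : ∀ {m Y} → m ≤ n → UpperCoeffs≤ m Y →
                       ∣ b m ∣ ≤ 2 ℕ.^ n ℕ.* (M ℕ.+ n ℕ.* (Y ℕ.* n ℕ.^ n))
  ∣poly-coeff∣≤-step {m} {Y} m≤n upper = begin
    ∣ b m ∣                                       ≤⟨ ℕP.m≤m*n ∣ b m ∣ (m !) {{ℕP._!≢0 m}} ⟩
    ∣ b m ∣ ℕ.* m !                               ≡⟨ trans (cong ∣_∣ (Δ-poly m b)) (ℤP.abs-* (b m) (+ (m !))) ⟨
    ∣ Δ m (poly b (suc m)) ∣                      ≤⟨ ∣Δ∣≤ m _ _ (λ x x≤m → ∣truncated-poly∣≤ m≤n upper x (ℕP.≤-trans x≤m m≤n)) ⟩
    2 ℕ.^ m ℕ.* (M ℕ.+ n ℕ.* (Y ℕ.* n ℕ.^ n))     ≤⟨ ℕP.*-monoˡ-≤ _ (ℕP.^-monoʳ-≤ 2 m≤n) ⟩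
    2 ℕ.^ n ℕ.* (M ℕ.+ n ℕ.* (Y ℕ.* n ℕ.^ n))     ∎
    where open ℕP.≤-Reasoning

  private
    instance
      coeffRatio≢0 : NonZero (coeffRatio n)
      coeffRatio≢0 = ℕP.m*n≢0 (2 ℕ.^ n) _ {{ℕP.m^n≢0 2 n}}

    absorb : ∀ d → 2 ℕ.^ n ℕ.* (M ℕ.+ n ℕ.* (M ℕ.* coeffRatio n ℕ.^ d ℕ.* n ℕ.^ n))
                   ≤ M ℕ.* coeffRatio n ℕ.^ suc d
    absorb d = begin
      P ℕ.* (M ℕ.+ n ℕ.* (M ℕ.* X ℕ.* Q))     ≡⟨ factor P M n X Q ⟩
      M ℕ.* (P ℕ.* (1 ℕ.+ n ℕ.* Q ℕ.* X))     ≤⟨ ℕP.*-monoʳ-≤ M (ℕP.*-monoʳ-≤ P (ℕP.+-monoˡ-≤ _ (ℕP.m^n>0 (coeffRatio n) d))) ⟩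
      M ℕ.* (P ℕ.* ((1 ℕ.+ n ℕ.* Q) ℕ.* X))   ≡⟨ cong (M ℕ.*_) (ℕP.*-assoc P _ X) ⟨
      M ℕ.* coeffRatio n ℕ.^ suc d            ∎
      where
      open ℕP.≤-Reasoning
      P : ℕ
      P = 2 ℕ.^ n
      Q : ℕ
      Q = n ℕ.^ n
      X : ℕ
      X = coeffRatio n ℕ.^ d
      factor : ∀ P M n X Q → P ℕ.* (M ℕ.+ n ℕ.* (M ℕ.* X ℕ.* Q)) ≡ M ℕ.* (P ℕ.* (1 ℕ.+ n ℕ.* Q ℕ.* X))
      factor = ℕSolver.solve-∀

  ∣poly-coeff∣≤-descending : ∀ d k → k ≤ n → n ≤ k ℕ.+ d → ∣ b k ∣ ≤ M ℕ.* coeffRatio n ℕ.^ suc d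
  ∣poly-coeff∣≤-descending d k k≤n n≤k+d = ℕP.≤-trans (∣poly-coeff∣≤-step k≤n (upper d n≤k+d)) (absorb d)
    where
    upper : ∀ d → n ≤ k ℕ.+ d → UpperCoeffs≤ k (M ℕ.* coeffRatio n ℕ.^ d)
    upper zero    n≤k+0   k′ k<k′ k′≤n =
      ⊥-elim (ℕP.<-irrefl refl (ℕP.<-≤-trans k<k′ (ℕP.≤-trans k′≤n (subst (n ≤_) (ℕP.+-identityʳ k) n≤k+0))))
    upper (suc d) n≤k+1+d k′ k<k′ k′≤n = ∣poly-coeff∣≤-descending d k′ k′≤n
      (ℕP.≤-trans n≤k+1+d (ℕP.≤-trans (ℕP.≤-reflexive (ℕP.+-suc k d)) (ℕP.+-monoˡ-≤ d k<k′)))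

  ∣poly-coeff∣≤ : ∀ k → k ≤ n → ∣ b k ∣ ≤ M ℕ.* coeffBound n
  ∣poly-coeff∣≤ k k≤n = ∣poly-coeff∣≤-descending n k k≤n (ℕP.m≤n+m n k)

sumℤ-triangle : ∀ n (a : ℕ → ℕ → ℤ) →
  sumℤ n (λ j → sumℤ (n ℕ.∸ j) (λ i → a j (j ℕ.+ i))) ≡ sumℤ n (λ k → sumℤ (suc k) (λ j → a j k))
sumℤ-triangle zero    a = refl
sumℤ-triangle (suc n) a = begin
  sumℤ n (λ j → sumℤ (suc n ℕ.∸ j) (row j)) + sumℤ (suc n ℕ.∸ n) (row n)
    ≡⟨ cong₂ _+_ (sumℤ-cong n row-grows) last-row ⟩
  sumℤ n (λ j → sumℤ (n ℕ.∸ j) (row j) + a j n) + a n n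
    ≡⟨ cong (_+ a n n) (sumℤ-distrib-+ n _ _) ⟩
  (sumℤ n (λ j → sumℤ (n ℕ.∸ j) (row j)) + sumℤ n (λ j → a j n)) + a n n
    ≡⟨ cong (λ z → z + sumℤ n (λ j → a j n) + a n n) (sumℤ-triangle n a) ⟩
  (sumℤ n (λ k → sumℤ (suc k) (λ j → a j k)) + sumℤ n (λ j → a j n)) + a n n
    ≡⟨ ℤP.+-assoc (sumℤ n (λ k → sumℤ (suc k) (λ j → a j k))) _ _ ⟩
  sumℤ n (λ k → sumℤ (suc k) (λ j → a j k)) + sumℤ (suc n) (λ j → a j n) ∎
  where
  open ≡-Reasoning
  row : ℕ → ℕ → ℤ
  row j i = a j (j ℕ.+ i)
  row-grows : ∀ j → j < n → sumℤ (suc n ℕ.∸ j) (row j) ≡ sumℤ (n ℕ.∸ j) (row j) + a j n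
  row-grows j j<n rewrite ℕP.+-∸-assoc 1 (ℕP.<⇒≤ j<n) | ℕP.m+[n∸m]≡n (ℕP.<⇒≤ j<n) = refl
  last-row : sumℤ (suc n ℕ.∸ n) (row n) ≡ a n n
  last-row rewrite ℕP.m+n∸n≡m 1 n | ℕP.+-identityʳ n = ℤP.+-identityˡ (a n n)

-- The coefficient of X k in ∑_{j ≤ t} W j · h X j (t - j).
coeff : ℕ → (ℕ → ℕ) → ℕ → ℤ
coeff t W k = sumℤ (suc k) (λ j → + W j * (sign (k ℕ.∸ j) * + ((t ℕ.∸ j) C (k ℕ.∸ j))))

sum-h≡sum-coeff : ∀ t (W : ℕ → ℕ) (X : ℕ → ℤ) →
  sumℤ (suc t) (λ j → + W j * h X j (t ℕ.∸ j)) ≡ sumℤ (suc t) (λ k → coeff t W k * X k)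
sum-h≡sum-coeff t W X = begin
  sumℤ (suc t) (λ j → + W j * h X j (t ℕ.∸ j))                   ≡⟨ sumℤ-cong (suc t) expand-row ⟩
  sumℤ (suc t) (λ j → sumℤ (suc t ℕ.∸ j) (λ i → a j (j ℕ.+ i)))  ≡⟨ sumℤ-triangle (suc t) a ⟩
  sumℤ (suc t) (λ k → sumℤ (suc k) (λ j → a j k))                ≡⟨ sumℤ-cong (suc t) (λ k _ → collect k) ⟩
  sumℤ (suc t) (λ k → coeff t W k * X k)                         ∎
  where
  open ≡-Reasoning
  a : ℕ → ℕ → ℤ
  a j k = + W j * (sign (k ℕ.∸ j) * + ((t ℕ.∸ j) C (k ℕ.∸ j)) * X k)
  expand-row : ∀ j → j < suc t → + W j * h X j (t ℕ.∸ j) ≡ sumℤ (suc t ℕ.∸ j) (λ i → a j (j ℕ.+ i))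
  expand-row j j<1+t rewrite ℕP.+-∸-assoc 1 (ℕP.≤-pred j<1+t) =
    trans (*-distribˡ-sumℤ (suc (t ℕ.∸ j)) (+ W j) _)
          (sumℤ-cong (suc (t ℕ.∸ j)) λ i _ →
             cong (λ l → + W j * (sign l * + ((t ℕ.∸ j) C l) * X (j ℕ.+ i))) (sym (ℕP.m+n∸m≡n j i)))
  collect : ∀ k → sumℤ (suc k) (λ j → a j k) ≡ coeff t W k * X k
  collect k = trans (sumℤ-cong (suc k) (λ j _ → sym (ℤP.*-assoc (+ W j) _ (X k))))
                    (sym (*-distribʳ-sumℤ (suc k) (X k) _))

neg-^ : ∀ (x : ℤ) i → (- x) ^ i ≡ sign i * x ^ i
neg-^ x zero    = refl
neg-^ x (suc i) = trans (cong (- x *_) (neg-^ x i)) (swap-sign x (sign i) (x ^ i))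
  where
  swap-sign : ∀ a s b → - a * (s * b) ≡ - s * (a * b)
  swap-sign = solve-∀

h-of-binomial-power : ∀ t j (x y : ℤ) →
  h (λ k → x ^ k * (x + y) ^ (t ℕ.∸ k)) j (t ℕ.∸ j) ≡ x ^ j * y ^ (t ℕ.∸ j)
h-of-binomial-power t j x y = begin
  sumℤ (suc n) (λ i → sign i * + (n C i) * (x ^ (j ℕ.+ i) * (x + y) ^ (t ℕ.∸ (j ℕ.+ i))))
    ≡⟨ sumℤ-cong (suc n) (λ i _ → factor i) ⟩
  sumℤ (suc n) (λ i → x ^ j * (+ (n C i) * ((- x) ^ i * (x + y) ^ (n ℕ.∸ i))))
    ≡⟨ *-distribˡ-sumℤ (suc n) (x ^ j) _ ⟨
  x ^ j * sumℤ (suc n) (λ i → + (n C i) * ((- x) ^ i * (x + y) ^ (n ℕ.∸ i)))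
    ≡⟨ cong (x ^ j *_) (binomial-theorem n (- x) (x + y)) ⟨
  x ^ j * (- x + (x + y)) ^ n
    ≡⟨ cong (λ z → x ^ j * z ^ n) (cancel x y) ⟩
  x ^ j * y ^ n ∎
  where
  open ≡-Reasoning
  n : ℕ
  n = t ℕ.∸ j
  cancel : ∀ x y → - x + (x + y) ≡ y
  cancel = solve-∀
  rearrange : ∀ s c A B C → s * c * (A * B * C) ≡ A * (c * (s * B * C))
  rearrange = solve-∀
  factor : ∀ i → sign i * + (n C i) * (x ^ (j ℕ.+ i) * (x + y) ^ (t ℕ.∸ (j ℕ.+ i)))
               ≡ x ^ j * (+ (n C i) * ((- x) ^ i * (x + y) ^ (n ℕ.∸ i)))
  factor i rewrite ℤP.^-distribˡ-+-* x j i | sym (ℕP.∸-+-assoc t j i) | neg-^ x i =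
    rearrange (sign i) (+ (n C i)) (x ^ j) (x ^ i) ((x + y) ^ (n ℕ.∸ i))

coeff-generating : ∀ t W (x y : ℤ) →
  sumℤ (suc t) (λ k → coeff t W k * (x ^ k * (x + y) ^ (t ℕ.∸ k)))
  ≡ sumℤ (suc t) (λ j → + W j * (x ^ j * y ^ (t ℕ.∸ j)))
coeff-generating t W x y = trans (sym (sum-h≡sum-coeff t W _))
  (sumℤ-cong (suc t) λ j _ → cong (+ W j *_) (h-of-binomial-power t j x y))

coeff-generatingℕ : ∀ t W {a N} → a ≤ N →
  sumℤ (suc t) (λ k → coeff t W k * ((+ a) ^ k * (+ N) ^ (t ℕ.∸ k)))
  ≡ + sumℕ (suc t) (λ j → W j ℕ.* (a ℕ.^ j ℕ.* (N ℕ.∸ a) ℕ.^ (t ℕ.∸ j)))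
coeff-generatingℕ t W {a} {N} a≤N = begin
  sumℤ (suc t) (λ k → coeff t W k * ((+ a) ^ k * (+ N) ^ (t ℕ.∸ k)))
    ≡⟨ cong (λ z → sumℤ (suc t) (λ k → coeff t W k * ((+ a) ^ k * z ^ (t ℕ.∸ k)))) a+b≡N ⟨
  sumℤ (suc t) (λ k → coeff t W k * ((+ a) ^ k * (+ a + + b) ^ (t ℕ.∸ k)))
    ≡⟨ coeff-generating t W (+ a) (+ b) ⟩
  sumℤ (suc t) (λ j → + W j * ((+ a) ^ j * (+ b) ^ (t ℕ.∸ j)))
    ≡⟨ pos-sumℕ-monomials t W a b ⟨
  + sumℕ (suc t) (λ j → W j ℕ.* (a ℕ.^ j ℕ.* b ℕ.^ (t ℕ.∸ j))) ∎
  where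
  open ≡-Reasoning
  b : ℕ
  b = N ℕ.∸ a
  a+b≡N : + a + + b ≡ + N
  a+b≡N = cong +_ (ℕP.m+[n∸m]≡n a≤N)

∣coeff-generating∣≤ : ∀ t W {a N} → (∀ j → j ≤ t → W j ≤ t C j) → a ≤ N →
  ∣ sumℤ (suc t) (λ k → coeff t W k * ((+ a) ^ k * (+ N) ^ (t ℕ.∸ k))) ∣ ≤ N ℕ.^ t
∣coeff-generating∣≤ t W {a} {N} W≤C a≤N = begin
  ∣ sumℤ (suc t) (λ k → coeff t W k * ((+ a) ^ k * (+ N) ^ (t ℕ.∸ k))) ∣
    ≡⟨ cong ∣_∣ (coeff-generatingℕ t W a≤N) ⟩
  sumℕ (suc t) (λ j → W j ℕ.* (a ℕ.^ j ℕ.* b ℕ.^ (t ℕ.∸ j)))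
    ≤⟨ sumℕ-mono-≤ (suc t) (λ j j<1+t → ℕP.*-monoˡ-≤ _ (W≤C j (ℕP.≤-pred j<1+t))) ⟩
  sumℕ (suc t) (λ j → (t C j) ℕ.* (a ℕ.^ j ℕ.* b ℕ.^ (t ℕ.∸ j)))
    ≡⟨ binomial-theoremℕ t a b ⟨
  (a ℕ.+ b) ℕ.^ t
    ≡⟨ cong (ℕ._^ t) (ℕP.m+[n∸m]≡n a≤N) ⟩
  N ℕ.^ t ∎
  where
  open ℕP.≤-Reasoning
  b : ℕ
  b = N ℕ.∸ a

coeff-not-all-zero : ∀ t W {j} → j ≤ t → W j ≢ 0 → ¬ (∀ k → k ≤ t → coeff t W k ≡ + 0)
coeff-not-all-zero t W {j} j≤t Wj≢0 all-zero =
  Wj≢0 (ℕP.n≤0⇒n≡0 (subst (W j ≤_) (ℤP.+-injective sum-W≡0) (term≤sumℕ (suc t) W (s≤s j≤t))))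
  where
  open ≡-Reasoning
  ones : ∀ j → + W j * ((+ 1) ^ j * (+ 1) ^ (t ℕ.∸ j)) ≡ + W j
  ones j = trans (cong (+ W j *_) (cong₂ _*_ (ℤP.^-zeroˡ j) (ℤP.^-zeroˡ (t ℕ.∸ j)))) (ℤP.*-identityʳ (+ W j))
  sum-W≡0 : + sumℕ (suc t) W ≡ + 0
  sum-W≡0 = begin
    + sumℕ (suc t) W
      ≡⟨ pos-sumℕ (suc t) W ⟩
    sumℤ (suc t) (λ j → + W j)
      ≡⟨ sumℤ-cong (suc t) (λ j _ → ones j) ⟨
    sumℤ (suc t) (λ j → + W j * ((+ 1) ^ j * (+ 1) ^ (t ℕ.∸ j)))
      ≡⟨ coeff-generating t W (+ 1) (+ 1) ⟨
    sumℤ (suc t) (λ k → coeff t W k * ((+ 1) ^ k * (+ 2) ^ (t ℕ.∸ k)))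
      ≡⟨ sumℤ-zero (suc t) _ (λ k k<1+t → cong (_* _) (all-zero k (ℕP.≤-pred k<1+t))) ⟩
    + 0 ∎

last-nonzero : ∀ n (c : ℕ → ℤ) → ¬ (∀ k → k ≤ n → c k ≡ + 0) →
  ∃ λ K → K ≤ n × c K ≢ + 0 × (∀ k → K < k → k ≤ n → c k ≡ + 0)
last-nonzero n c not-all-zero with c n ℤ.≟ + 0
... | no cn≢0 = n , ℕP.≤-refl , cn≢0 , λ k n<k k≤n → ⊥-elim (ℕP.<-irrefl refl (ℕP.<-≤-trans n<k k≤n))
last-nonzero zero    c not-all-zero | yes c0≡0 = ⊥-elim (not-all-zero λ { zero z≤n → c0≡0 })
last-nonzero (suc n) c not-all-zero | yes cn≡0
  with last-nonzero n c (λ all-below → not-all-zero (up-to-suc all-below))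
  where
  up-to-suc : (∀ k → k ≤ n → c k ≡ + 0) → ∀ k → k ≤ suc n → c k ≡ + 0
  up-to-suc all-below k k≤1+n with ℕP.m≤n⇒m<n∨m≡n k≤1+n
  ... | inj₁ k<1+n = all-below k (ℕP.≤-pred k<1+n)
  ... | inj₂ refl  = cn≡0
... | K , K≤n , cK≢0 , above-zero = K , ℕP.m≤n⇒m≤1+n K≤n , cK≢0 , above-zero′
  where
  above-zero′ : ∀ k → K < k → k ≤ suc n → c k ≡ + 0
  above-zero′ k K<k k≤1+n with ℕP.m≤n⇒m<n∨m≡n k≤1+n
  ... | inj₁ k<1+n = above-zero k K<k (ℕP.≤-pred k<1+n)
  ... | inj₂ refl  = cn≡0

∣coeff∣≤-last : ∀ t W {K} → 1 ≤ K → K ≤ t → (∀ j → j ≤ t → W j ≤ t C j) →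
  (∀ k → K < k → k ≤ t → coeff t W k ≡ + 0) →
  ∀ k → k ≤ K → ∣ coeff t W k ∣ ≤ K ℕ.^ K ℕ.* coeffBound K
∣coeff∣≤-last t W {K} 1≤K K≤t W≤C above-zero k k≤K =
  ℕP.≤-trans (ℕP.*-cancelʳ-≤ ∣ c k ∣ (K ℕ.^ k ℕ.* coeffBound K) (K ℕ.^ (t ℕ.∸ k)) scaled)
             (ℕP.*-monoˡ-≤ (coeffBound K) (ℕP.^-monoʳ-≤ K k≤K))
  where
  instance
    K≢0 : NonZero K
    K≢0 = ℕ.>-nonZero 1≤K
    K^[t-k]≢0 : NonZero (K ℕ.^ (t ℕ.∸ k))
    K^[t-k]≢0 = ℕP.m^n≢0 K (t ℕ.∸ k)
  c : ℕ → ℤ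
  c = coeff t W
  b : ℕ → ℤ
  b k = c k * (+ K) ^ (t ℕ.∸ k)
  poly≡generating : ∀ x → poly b (suc K) x ≡ sumℤ (suc t) (λ k → c k * ((+ x) ^ k * (+ K) ^ (t ℕ.∸ k)))
  poly≡generating x = trans (sumℤ-cong (suc K) λ k _ → swap (c k) _ ((+ x) ^ k))
    (sym (sumℤ-truncate _ (s≤s K≤t) λ k K<k k<1+t →
      trans (cong (_* _) (above-zero k K<k (ℕP.≤-pred k<1+t))) (ℤP.*-zeroˡ ((+ x) ^ k * (+ K) ^ (t ℕ.∸ k)))))
    where
    swap : ∀ a b c → a * b * c ≡ a * (c * b)
    swap = solve-∀
  poly-bounded : ∀ x → x ≤ K → ∣ poly b (suc K) x ∣ ≤ K ℕ.^ t
  poly-bounded x x≤K = subst (_≤ K ℕ.^ t) (cong ∣_∣ (sym (poly≡generating x))) (∣coeff-generating∣≤ t W W≤C x≤K)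
  scaled : ∣ c k ∣ ℕ.* K ℕ.^ (t ℕ.∸ k) ≤ K ℕ.^ k ℕ.* coeffBound K ℕ.* K ℕ.^ (t ℕ.∸ k)
  scaled = begin
    ∣ c k ∣ ℕ.* K ℕ.^ (t ℕ.∸ k)                            ≡⟨ ∣b∣ ⟨
    ∣ b k ∣                                                ≤⟨ ∣poly-coeff∣≤ K b (K ℕ.^ t) poly-bounded k k≤K ⟩
    K ℕ.^ t ℕ.* coeffBound K                               ≡⟨ cong (λ e → K ℕ.^ e ℕ.* coeffBound K) (ℕP.m+[n∸m]≡n k≤t) ⟨
    K ℕ.^ (k ℕ.+ (t ℕ.∸ k)) ℕ.* coeffBound K               ≡⟨ cong (ℕ._* coeffBound K) (ℕP.^-distribˡ-+-* K k (t ℕ.∸ k)) ⟩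
    K ℕ.^ k ℕ.* K ℕ.^ (t ℕ.∸ k) ℕ.* coeffBound K           ≡⟨ swap (K ℕ.^ k) _ (coeffBound K) ⟩
    K ℕ.^ k ℕ.* coeffBound K ℕ.* K ℕ.^ (t ℕ.∸ k)           ∎
    where
    open ℕP.≤-Reasoning
    k≤t : k ≤ t
    k≤t = ℕP.≤-trans k≤K K≤t
    ∣b∣ : ∣ b k ∣ ≡ ∣ c k ∣ ℕ.* K ℕ.^ (t ℕ.∸ k)
    ∣b∣ = trans (ℤP.abs-* (c k) ((+ K) ^ (t ℕ.∸ k))) (cong (∣ c k ∣ ℕ.*_) (∣pos-^∣ K (t ℕ.∸ k)))
    swap : ∀ a b c → a ℕ.* b ℕ.* c ≡ a ℕ.* c ℕ.* b
    swap = ℕSolver.solve-∀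

n<2^n : ∀ n → n < 2 ℕ.^ n
n<2^n zero    = s≤s z≤n
n<2^n (suc n) = ℕP.≤-trans (ℕP.+-mono-≤ (ℕP.m^n>0 2 n) (n<2^n n))
                           (ℕP.≤-reflexive (cong (2 ℕ.^ n ℕ.+_) (sym (ℕP.+-identityʳ (2 ℕ.^ n)))))

K^K*coeffBound≤f : ∀ K → 1 ≤ K → K ℕ.^ K ℕ.* coeffBound K ≤ f K
K^K*coeffBound≤f K@(suc k) (s≤s z≤n) = begin
  K ℕ.^ K ℕ.* coeffBound K                  ≤⟨ ℕP.*-mono-≤ (ℕP.^-monoˡ-≤ K K≤2^K) (ℕP.^-monoˡ-≤ (suc K) ratio≤) ⟩
  (2 ℕ.^ K) ℕ.^ K ℕ.* (2 ℕ.^ e) ℕ.^ suc K   ≡⟨ cong₂ ℕ._*_ (ℕP.^-*-assoc 2 K K) (ℕP.^-*-assoc 2 e (suc K)) ⟩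
  2 ℕ.^ (K ℕ.* K) ℕ.* 2 ℕ.^ (e ℕ.* suc K)   ≡⟨ ℕP.^-distribˡ-+-* 2 (K ℕ.* K) (e ℕ.* suc K) ⟨
  2 ℕ.^ (K ℕ.* K ℕ.+ e ℕ.* suc K)           ≤⟨ ℕP.^-monoʳ-≤ 2 exponent≤ ⟩
  f K                                       ∎
  where
  open ℕP.≤-Reasoning
  e : ℕ
  e = K ℕ.+ suc (K ℕ.* suc K)
  K≤2^K : K ≤ 2 ℕ.^ K
  K≤2^K = ℕP.<⇒≤ (n<2^n K)
  1+K^[1+K]≤ : 1 ℕ.+ K ℕ.^ suc K ≤ 2 ℕ.^ suc (K ℕ.* suc K)
  1+K^[1+K]≤ = begin
    1 ℕ.+ X      ≤⟨ ℕP.+-monoˡ-≤ X (ℕP.m^n>0 K (suc K)) ⟩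
    X ℕ.+ X      ≤⟨ ℕP.+-mono-≤ X≤Y X≤Y ⟩
    Y ℕ.+ Y      ≡⟨ cong (Y ℕ.+_) (ℕP.+-identityʳ Y) ⟨
    2 ℕ.* Y      ∎
    where
    X : ℕ
    X = K ℕ.^ suc K
    Y : ℕ
    Y = 2 ℕ.^ (K ℕ.* suc K)
    X≤Y : X ≤ Y
    X≤Y = ℕP.≤-trans (ℕP.^-monoˡ-≤ (suc K) K≤2^K) (ℕP.≤-reflexive (ℕP.^-*-assoc 2 K (suc K)))
  ratio≤ : coeffRatio K ≤ 2 ℕ.^ e
  ratio≤ = begin
    2 ℕ.^ K ℕ.* (1 ℕ.+ K ℕ.^ suc K)           ≤⟨ ℕP.*-monoʳ-≤ (2 ℕ.^ K) 1+K^[1+K]≤ ⟩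
    2 ℕ.^ K ℕ.* 2 ℕ.^ suc (K ℕ.* suc K)       ≡⟨ ℕP.^-distribˡ-+-* 2 K _ ⟨
    2 ℕ.^ e                                   ∎
  -- With K = 1 + k the exponent is K² + (K+1)³, and the remainder below brings it to (2K)⁴.
  polynomial : ∀ k → (1 ℕ.+ k) ℕ.* (1 ℕ.+ k) ℕ.+ ((1 ℕ.+ k) ℕ.+ (1 ℕ.+ (1 ℕ.+ k) ℕ.* (2 ℕ.+ k))) ℕ.* (2 ℕ.+ k)
                     ℕ.+ (16 ℕ.* k ℕ.* k ℕ.* k ℕ.* k ℕ.+ 63 ℕ.* k ℕ.* k ℕ.* k ℕ.+ 89 ℕ.* k ℕ.* k ℕ.+ 50 ℕ.* k ℕ.+ 7)
                   ≡ let x = 2 ℕ.* (1 ℕ.+ k) in x ℕ.* (x ℕ.* (x ℕ.* (x ℕ.* 1)))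
  polynomial = ℕSolver.solve-∀
  exponent≤ : K ℕ.* K ℕ.+ e ℕ.* suc K ≤ (100 ℕ.* K) ℕ.^ 10
  exponent≤ = begin
    K ℕ.* K ℕ.+ e ℕ.* suc K   ≤⟨ ℕP.m≤m+n _ _ ⟩
    _                         ≡⟨ polynomial k ⟩
    (2 ℕ.* K) ℕ.^ 4           ≤⟨ ℕP.^-monoˡ-≤ 4 (ℕP.*-monoˡ-≤ K (ℕP.m≤m+n 2 98)) ⟩
    (100 ℕ.* K) ℕ.^ 4         ≤⟨ ℕP.^-monoʳ-≤ (100 ℕ.* K) (ℕP.m≤m+n 4 6) ⟩
    (100 ℕ.* K) ℕ.^ 10        ∎

growth-strict : ∀ {p} → p 0 ≢ + 0 → Growth p → ∀ K → f K ℕ.* sumℕ K (λ i → ∣ p i ∣) < ∣ p K ∣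
growth-strict p0≢0 growth zero    = ℕP.n≢0⇒n>0 (λ ∣p0∣≡0 → p0≢0 (ℤP.∣i∣≡0⇒i≡0 ∣p0∣≡0))
growth-strict p0≢0 growth (suc K) = growth (suc K) (s≤s z≤n)

∣i∣<∣j∣⇒i+j≢0 : ∀ i j → ∣ i ∣ < ∣ j ∣ → i + j ≢ + 0
∣i∣<∣j∣⇒i+j≢0 i j ∣i∣<∣j∣ i+j≡0 = ℕP.<-irrefl ∣i∣≡∣j∣ ∣i∣<∣j∣
  where
  ∣i∣≡∣j∣ : ∣ i ∣ ≡ ∣ j ∣
  ∣i∣≡∣j∣ = trans (sym (ℤP.∣-i∣≡∣i∣ i)) (cong ∣_∣ (sym (inverseʳ-unique i j i+j≡0)))

growth-dominates : ∀ {p} → p 0 ≢ + 0 → Growth p → ∀ K (c : ℕ → ℤ) → c K ≢ + 0 →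
  (∀ k → k < K → ∣ c k ∣ ≤ f K) → sumℤ (suc K) (λ k → c k * p k) ≢ + 0
growth-dominates {p} p0≢0 growth K c cK≢0 small = ∣i∣<∣j∣⇒i+j≢0 (sumℤ K (λ k → c k * p k)) (c K * p K) $ begin-strict
  ∣ sumℤ K (λ k → c k * p k) ∣               ≤⟨ ∣sumℤ∣≤sumℕ∣∣ K _ ⟩
  sumℕ K (λ k → ∣ c k * p k ∣)               ≤⟨ sumℕ-mono-≤ K ∣term∣≤ ⟩
  sumℕ K (λ k → f K ℕ.* ∣ p k ∣)             ≡⟨ *-distribˡ-sumℕ K (f K) (λ k → ∣ p k ∣) ⟨
  f K ℕ.* sumℕ K (λ k → ∣ p k ∣)             <⟨ growth-strict {p} p0≢0 growth K ⟩
  ∣ p K ∣                                    ≤⟨ ℕP.m≤n*m ∣ p K ∣ ∣ c K ∣ ⟩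
  ∣ c K ∣ ℕ.* ∣ p K ∣                        ≡⟨ ℤP.abs-* (c K) (p K) ⟨
  ∣ c K * p K ∣                              ∎
  where
  open ℕP.≤-Reasoning
  instance
    ∣cK∣≢0 : NonZero ∣ c K ∣
    ∣cK∣≢0 = ℕ.≢-nonZero (λ ∣cK∣≡0 → cK≢0 (ℤP.∣i∣≡0⇒i≡0 ∣cK∣≡0))
  ∣term∣≤ : ∀ k → k < K → ∣ c k * p k ∣ ≤ f K ℕ.* ∣ p k ∣
  ∣term∣≤ k k<K = ℕP.≤-trans (ℕP.≤-reflexive (ℤP.abs-* (c k) (p k))) (ℕP.*-monoˡ-≤ ∣ p k ∣ (small k k<K))

coeff-sum≢0 : ∀ {p} → p 0 ≢ + 0 → Growth p → ∀ t W → (∀ j → j ≤ t → W j ≤ t C j) →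
  ∀ {j} → j ≤ t → W j ≢ 0 → sumℤ (suc t) (λ k → coeff t W k * p k) ≢ + 0
coeff-sum≢0 {p} p0≢0 growth t W W≤C j≤t Wj≢0 with last-nonzero t (coeff t W) (coeff-not-all-zero t W j≤t Wj≢0)
... | K , K≤t , cK≢0 , above-zero = λ sum≡0 →
  growth-dominates p0≢0 growth K (coeff t W) cK≢0 small (trans (sym truncate) sum≡0)
  where
  small : ∀ k → k < K → ∣ coeff t W k ∣ ≤ f K
  small k k<K = ℕP.≤-trans (∣coeff∣≤-last t W 1≤K K≤t W≤C above-zero k (ℕP.<⇒≤ k<K)) (K^K*coeffBound≤f K 1≤K)
    where
    1≤K : 1 ≤ K
    1≤K = ℕP.<-≤-trans (s≤s z≤n) k<K
  truncate : sumℤ (suc t) (λ k → coeff t W k * p k) ≡ sumℤ (suc K) (λ k → coeff t W k * p k)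
  truncate = sumℤ-truncate _ (s≤s K≤t) λ k K<k k<1+t →
    trans (cong (_* p k) (above-zero k K<k (ℕP.≤-pred k<1+t))) (ℤP.*-zeroˡ (p k))

extend : ∀ t → (Fin (suc t) → ℕ) → ℕ → ℕ
extend t w i with i ℕ.<? suc t
... | yes i<1+t = w (Fin.fromℕ< i<1+t)
... | no  _     = 0

extend-toℕ : ∀ t w (j : Fin (suc t)) → extend t w (toℕ j) ≡ w j
extend-toℕ t w j with toℕ j ℕ.<? suc t
... | yes j<1+t = cong w (FinP.fromℕ<-toℕ j j<1+t)
... | no  j≮1+t = ⊥-elim (j≮1+t (FinP.toℕ<n j))

extend-≤ : ∀ t w {B : ℕ → ℕ} → (∀ j → w j ≤ B (toℕ j)) → ∀ i → extend t w i ≤ B i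
extend-≤ t w {B} w≤B i with i ℕ.<? suc t
... | yes i<1+t = subst (λ l → w (Fin.fromℕ< i<1+t) ≤ B l) (FinP.toℕ-fromℕ< i<1+t) (w≤B (Fin.fromℕ< i<1+t))
... | no  _     = z≤n

weightedSum≡sum-coeff : ∀ p t w → weightedSum p t w ≡ sumℤ (suc t) (λ k → coeff t (extend t w) k * p k)
weightedSum≡sum-coeff p t w = begin
  weightedSum p t w                          ≡⟨ sumFin-cong (suc t) (λ j → cong (λ z → + z * column (toℕ j)) (extend-toℕ t w j)) ⟨
  sumFin (suc t) (λ j → term (toℕ j))        ≡⟨ sumFin≡sumℤ (suc t) term ⟩
  sumℤ (suc t) term                          ≡⟨ sum-h≡sum-coeff t W p ⟩
  sumℤ (suc t) (λ k → coeff t W k * p k)     ∎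
  where
  open ≡-Reasoning
  W : ℕ → ℕ
  W = extend t w
  column : ℕ → ℤ
  column j = h p j (t ℕ.∸ j)
  term : ℕ → ℤ
  term j = + W j * column j

theorem3 : (p : ℕ → ℤ) → p 0 ≢ + 0 → Growth p →
    (t : ℕ) → (w : Fin (suc t) → ℕ) →
    ∃ (λ j → w j ≢ 0) →
    (∀ j → w j ≤ t C toℕ j) →
    weightedSum p t w ≢ + 0
theorem3 p p0≢0 growth t w (j , wj≢0) w≤C rewrite weightedSum≡sum-coeff p t w =
  coeff-sum≢0 p0≢0 growth t (extend t w) (λ i _ → extend-≤ t w w≤C i)
    (FinP.toℕ≤pred[n] j) (λ Wj≡0 → wj≢0 (trans (sym (extend-toℕ t w j)) Wj≡0))
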